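{- Let $k\ge 0$. Then: (i) If $\sigma\in\mathcal{N}(S_{3,k})$ and $N(\sigma)\cap V_u^k\neq\emptyset$, then $\sigma$ consists only of stable vertices. (ii) $\mathcal{N}(S_{3,k})$ is the disjoint union $$\mathcal{N}(S_{3,k})=\mathcal{N}(SG_{3,k})\sqcup\Big(\bigsqcup_{s\in[k+6]}\bigsqcup_{t\in I_s}A_k^{s,t}\Big)\sqcup\Big(\bigsqcup_{s\in[k+4]}\bigsqcup_{u\in J_s}B_k^{s,u}\Big)\sqcup C_k .$$ (iii) Let $\{a_k^1>a_k^2>a_k^3>a_k^4\}$ be a four-element chain and define $\varphi_k$ on the face poset $\mathcal{F}(\mathcal{N}(S_{3,k}))$ by $\varphi_k(\sigma)=a_k^1$ if $\sigma$ lies in some $A_k^{s,t}$ ($s\in[k+6]$, $t\in I_s$), $\varphi_k(\sigma)=a_k^2$ if $\sigma$ lies in some $B_k^{s,u}$ ($s\in[k+4]$, $u\in J_s$), $\varphi_k(\sigma)=a_k^3$ if $\sigma\in C_k$, and $\varphi_k(\sigma)=a_k^4$ if $\sigma\in\mathcal{N}(SG_{3,k})$. Then $\varphi_k$ is order-preserving, i.e. $\tau\subseteq\sigma$ implies $\varphi_k(\tau)\le\varphi_k(\sigma)$.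
   Context: For a positive integer $n$, $[n]=\{1,\dots,n\}$. Arithmetic on elements of $[k+6]$ is modulo $k+6$ with representatives in $[k+6]$. $KG_{3,k}$ has as vertices the $3$-element subsets of $[k+6]$, adjacent iff disjoint. A vertex $v$ is stable if there is no $t\in[k+6]$ with $\{t,t+1\}\subseteq v$ (mod $k+6$), unstable otherwise; $V_u^k$ is the set of unstable vertices. $SG_{3,k}$ is the induced subgraph on stable vertices; $S_{3,k}$ has the same vertices as $KG_{3,k}$ and the edges of $KG_{3,k}$ with at least one stable endpoint. The neighborhood complex $\mathcal{N}(G)$ has as simplices the nonempty vertex sets with a common neighbor in $G$; its face poset $\mathcal{F}(\cdot)$ is the set of its simplices ordered by inclusion. For a set $\sigma$ of vertices, $N(\sigma)$ is the set of vertices of $S_{3,k}$ adjacent in $S_{3,k}$ to every element of $\sigma$, and $C_\sigma=[k+6]\setminus\bigcup_{\alpha\in\sigma}\alpha$. For $s\in[k+6]$: $I_s=[k+6]\setminus\{s-1,s,s+1\}$; $J_s=[k+5]\setminus[2]$ if $s=1$, $J_s=[k+6]\setminus[s+1]$ if $1<s<k+5$, and $J_s=\emptyset$ otherwise. For $t\in I_s$, $u\in J_s$: $A_k^{s,t}=\{\sigma\in\mathcal{N}(S_{3,k}) : C_\sigma=\{s,s+1,t\}\}$, $B_k^{s,u}=\{\sigma\in\mathcal{N}(S_{3,k}) : C_\sigma=\{s,s+1,u,u+1\}\}$, and $C_k=\{\sigma\in\mathcal{N}(S_{3,k}) : \sigma\cap V_u^k\neq\emptyset\}$. -}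

module Defs where

open import Data.Nat using (ℕ; zero; suc; _+_; _≤_; _<_)
open import Data.Nat.DivMod using (_mod_)
open import Data.Fin using (Fin; toℕ)
open import Data.Fin.Subset using (Subset; _∈_; _∉_; ∣_∣)
open import Data.Bool using (Bool; T)
open import Data.Product using (Σ; ∃; _×_; proj₁)
open import Data.Unit using (⊤)
open import Data.Sum using (_⊎_)
open import Relation.Nullary using (¬_)
open import Relation.Binary.PropositionalEquality using (_≡_; _≢_)
open import Function.Bundles using (_⇔_)

-- Ground set [k+6], encoded 0-based as Fin (6 + k): the element i : Fin (6+k)
-- stands for the paper's element (toℕ i + 1).
N : ℕ → ℕ
N k = 6 + k

next : ∀ {k} → Fin (N k) → Fin (N k)
next {k} i = (suc (toℕ i)) mod (N k)

prev : ∀ {k} → Fin (N k) → Fin (N k)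
prev {k} i = (toℕ i + (5 + k)) mod (N k)

-- vertices of KG_{3,k}: 3-element subsets of [k+6]
Vertex : ℕ → Set
Vertex k = Σ (Subset (N k)) (λ v → ∣ v ∣ ≡ 3)

elems : ∀ {k} → Vertex k → Subset (N k)
elems = proj₁

Unstable : ∀ {k} → Vertex k → Set
Unstable {k} v = ∃ λ (t : Fin (N k)) → (t ∈ elems v) × (next t ∈ elems v)

Stable : ∀ {k} → Vertex k → Set
Stable v = ¬ Unstable v

Disj : ∀ {k} → Vertex k → Vertex k → Set
Disj {k} v w = (x : Fin (N k)) → x ∈ elems v → x ∉ elems w

-- edges of S_{3,k}: KG-edges with at least one stable endpoint
EdgeS : ∀ {k} → Vertex k → Vertex k → Set
EdgeS v w = Disj v w × (Stable v ⊎ Stable w)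

VSet : ℕ → Set
VSet k = Vertex k → Bool

_∈V_ : ∀ {k} → Vertex k → VSet k → Set
v ∈V σ = T (σ v)

_⊆V_ : ∀ {k} → VSet k → VSet k → Set
_⊆V_ {k} τ σ = (v : Vertex k) → v ∈V τ → v ∈V σ

NonEmptyV : ∀ {k} → VSet k → Set
NonEmptyV {k} σ = ∃ λ (v : Vertex k) → v ∈V σ

InNS : ∀ {k} → VSet k → Set
InNS {k} σ = NonEmptyV σ × (∃ λ (w : Vertex k) → (v : Vertex k) → v ∈V σ → EdgeS v w)

-- σ ∈ 𝒩(SG_{3,k}): SG is the induced subgraph of KG on stable vertices
InNSG : ∀ {k} → VSet k → Set
InNSG {k} σ = NonEmptyV σ × ((v : Vertex k) → v ∈V σ → Stable v)
  × (∃ λ (w : Vertex k) → Stable w × ((v : Vertex k) → v ∈V σ → Disj v w))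

InNbr : ∀ {k} → VSet k → Vertex k → Set
InNbr {k} σ w = (v : Vertex k) → v ∈V σ → EdgeS v w

InC : ∀ {k} → VSet k → Fin (N k) → Set
InC {k} σ x = (v : Vertex k) → v ∈V σ → x ∉ elems v

InI : ∀ {k} → Fin (N k) → Fin (N k) → Set
InI s t = (t ≢ prev s) × (t ≢ s) × (t ≢ next s)

-- u ∈ J_s, written with the paper's 1-based values S = toℕ s + 1, U = toℕ u + 1:
-- S = 1 : J = {3,…,k+5};  1 < S < k+5 : J = {S+2,…,k+6};  otherwise J = ∅.
InJ : ∀ {k} → Fin (N k) → Fin (N k) → Set
InJ {k} s u =
  (suc (toℕ s) ≡ 1 × 3 ≤ suc (toℕ u) × suc (toℕ u) ≤ k + 5)
  ⊎ (1 < suc (toℕ s) × suc (toℕ s) < k + 5 × suc (suc (toℕ s)) < suc (toℕ u))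

InA : ∀ {k} → Fin (N k) → Fin (N k) → VSet k → Set
InA {k} s t σ = InNS σ
  × ((x : Fin (N k)) → InC σ x ⇔ (x ≡ s ⊎ x ≡ next s ⊎ x ≡ t))

InB : ∀ {k} → Fin (N k) → Fin (N k) → VSet k → Set
InB {k} s u σ = InNS σ
  × ((x : Fin (N k)) → InC σ x ⇔ (x ≡ s ⊎ x ≡ next s ⊎ x ≡ u ⊎ x ≡ next u))

InCk : ∀ {k} → VSet k → Set
InCk {k} σ = InNS σ × (∃ λ (v : Vertex k) → v ∈V σ × Unstable v)

data Piece (k : ℕ) : Set where
  pSG : Piece k
  pA  : Fin (N k) → Fin (N k) → Piece k
  pB  : Fin (N k) → Fin (N k) → Piece k
  pC  : Piece k

Valid : ∀ {k} → Piece k → Set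
Valid pSG = ⊤
Valid (pA s t) = InI s t
Valid {k} (pB s u) = (toℕ s < k + 4) × InJ s u
Valid pC = ⊤

InPiece : ∀ {k} → VSet k → Piece k → Set
InPiece σ pSG = InNSG σ
InPiece σ (pA s t) = InA s t σ
InPiece σ (pB s u) = InB s u σ
InPiece σ pC = InCk σ

-- values of φ_k in the chain a¹ > a² > a³ > a⁴, encoded as 4 > 3 > 2 > 1
φval : ∀ {k} → Piece k → ℕ
φval pSG = 1
φval (pA _ _) = 4
φval (pB _ _) = 3
φval pC = 2

module Submission where

-- For σ ∈ 𝒩(S_{3,k}) with common neighbour w, the set C_σ of points missed by σ
-- contains w.  Two decidable properties sort σ into the pieces: whether σ has an
-- unstable vertex (then σ ∈ C_k, and its neighbour is stable and lies in C_σ) and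
-- whether C_σ contains a stable vertex (true on C_k and 𝒩(SG_{3,k})).  If neither
-- holds, w is unstable, so C_σ contains a consecutive pair t, t+1 and a third point,
-- but no three pairwise non-consecutive points; a combinatorial classification of
-- such subsets of the cycle ℤ/(k+6) shows C_σ = {s, s+1, t} or {p, p+1, q, q+1},
-- i.e. σ lies in some A_k^{s,t} or B_k^{s,u}.  These shapes are rigid (they
-- determine their indices) and contain only unstable vertices, which gives
-- disjointness and, since C_σ ⊆ C_τ for τ ⊆ σ, monotonicity of φ_k.

open import Defs
open import Data.Nat using (ℕ; zero; suc; _+_; _∸_; _≤_; _<_; _%_; _<ᵇ_; z≤n; s≤s; s≤s⁻¹)
import Data.Nat.Properties as ℕ
open import Data.Nat.DivMod using (m<n⇒m%n≡m; n%n≡0; %-distribˡ-+; m%n%n≡m%n; [m+n]%n≡m%n; m≤n⇒[n∸m]%m≡n%m)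
open import Data.Fin using (Fin; toℕ)
open import Data.Fin.Properties using (toℕ-injective; toℕ-fromℕ<; toℕ<n; _≟_; any?; all?)
open import Data.Fin.Subset using (Subset; _∈_; ∣_∣; ⁅_⁆; _∪_; _-_; inside; outside)
open import Data.Fin.Subset.Properties
  using (_∈?_; anySubset?; x∈⁅x⁆; x∈⁅y⁆⇒x≡y; x∈p∧x≢y⇒x∈p-y; x∈p⇒∣p-x∣<∣p∣; p⊆q⇒∣p∣≤∣q∣; p⊆p∪q; q⊆p∪q; x∈p∪q⁻; ∣⁅x⁆∣≡1)
open import Data.Vec using (_∷_; [])
open import Data.Bool using (T)
open import Data.Unit using (tt)
open import Data.Product using (Σ; ∃; _×_; _,_; proj₁; proj₂)
open import Data.Sum using (_⊎_; inj₁; inj₂)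
open import Data.Empty using (⊥; ⊥-elim)
open import Relation.Nullary using (¬_; Dec; yes; no)
open import Relation.Nullary.Decidable using (False; toWitnessFalse; T?; ¬?; _×-dec_; _→-dec_)
open import Relation.Binary using (tri<; tri≈; tri>)
open import Relation.Binary.PropositionalEquality
open import Function.Base using (_∘′_)
open import Function.Bundles using (_⇔_; mk⇔; Equivalence)

∣p∪q∣≤∣p∣+∣q∣ : ∀ {n} (p q : Subset n) → ∣ p ∪ q ∣ ≤ ∣ p ∣ + ∣ q ∣
∣p∪q∣≤∣p∣+∣q∣ [] [] = z≤n
∣p∪q∣≤∣p∣+∣q∣ (inside ∷ p) (inside ∷ q) =
  s≤s (ℕ.≤-trans (ℕ.m≤n⇒m≤1+n (∣p∪q∣≤∣p∣+∣q∣ p q)) (ℕ.≤-reflexive (sym (ℕ.+-suc ∣ p ∣ ∣ q ∣))))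
∣p∪q∣≤∣p∣+∣q∣ (inside ∷ p) (outside ∷ q) = s≤s (∣p∪q∣≤∣p∣+∣q∣ p q)
∣p∪q∣≤∣p∣+∣q∣ (outside ∷ p) (inside ∷ q) =
  ℕ.≤-trans (s≤s (∣p∪q∣≤∣p∣+∣q∣ p q)) (ℕ.≤-reflexive (sym (ℕ.+-suc ∣ p ∣ ∣ q ∣)))
∣p∪q∣≤∣p∣+∣q∣ (outside ∷ p) (outside ∷ q) = ∣p∪q∣≤∣p∣+∣q∣ p q

three-not-in-pair : ∀ {n} (p : Subset n) (a b : Fin n) → ∣ p ∣ ≡ 3 →
                    (∀ x → x ∈ p → x ≡ a ⊎ x ≡ b) → ⊥
three-not-in-pair p a b ∣p∣≡3 p⊆ab = 3≰2 (subst (_≤ 2) ∣p∣≡3 ∣p∣≤2)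
  where
    3≰2 : ¬ (3 ≤ 2)
    3≰2 (s≤s (s≤s ()))
    p⊆⁅a⁆∪⁅b⁆ : ∀ {x} → x ∈ p → x ∈ ⁅ a ⁆ ∪ ⁅ b ⁆
    p⊆⁅a⁆∪⁅b⁆ {x} x∈p with p⊆ab x x∈p
    ... | inj₁ refl = p⊆p∪q ⁅ b ⁆ (x∈⁅x⁆ x)
    ... | inj₂ refl = q⊆p∪q ⁅ a ⁆ ⁅ b ⁆ (x∈⁅x⁆ x)
    ∣p∣≤2 : ∣ p ∣ ≤ 2
    ∣p∣≤2 = ℕ.≤-trans (p⊆q⇒∣p∣≤∣q∣ p⊆⁅a⁆∪⁅b⁆)
              (ℕ.≤-trans (∣p∪q∣≤∣p∣+∣q∣ ⁅ a ⁆ ⁅ b ⁆)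
                (ℕ.≤-reflexive (cong₂ _+_ (∣⁅x⁆∣≡1 a) (∣⁅x⁆∣≡1 b))))

triple : ∀ {n} → Fin n → Fin n → Fin n → Subset n
triple x y z = ⁅ x ⁆ ∪ ⁅ y ⁆ ∪ ⁅ z ⁆

triple-members : ∀ {n} (x y z : Fin n) {w} → w ∈ triple x y z → w ≡ x ⊎ w ≡ y ⊎ w ≡ z
triple-members x y z w∈ with x∈p∪q⁻ ⁅ x ⁆ (⁅ y ⁆ ∪ ⁅ z ⁆) w∈
... | inj₁ w∈x = inj₁ (x∈⁅y⁆⇒x≡y x w∈x)
... | inj₂ w∈yz with x∈p∪q⁻ ⁅ y ⁆ ⁅ z ⁆ w∈yz
...   | inj₁ w∈y = inj₂ (inj₁ (x∈⁅y⁆⇒x≡y y w∈y))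
...   | inj₂ w∈z = inj₂ (inj₂ (x∈⁅y⁆⇒x≡y z w∈z))

triple-size : ∀ {n} (x y z : Fin n) → x ≢ y → x ≢ z → y ≢ z → ∣ triple x y z ∣ ≡ 3
triple-size x y z x≢y x≢z y≢z = ℕ.≤-antisym at-most at-least
  where
    x∈ : x ∈ triple x y z
    x∈ = p⊆p∪q (⁅ y ⁆ ∪ ⁅ z ⁆) (x∈⁅x⁆ x)
    y∈ : y ∈ triple x y z
    y∈ = q⊆p∪q ⁅ x ⁆ (⁅ y ⁆ ∪ ⁅ z ⁆) (p⊆p∪q ⁅ z ⁆ (x∈⁅x⁆ y))
    z∈ : z ∈ triple x y z
    z∈ = q⊆p∪q ⁅ x ⁆ (⁅ y ⁆ ∪ ⁅ z ⁆) (q⊆p∪q ⁅ y ⁆ ⁅ z ⁆ (x∈⁅x⁆ z))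
    at-most : ∣ triple x y z ∣ ≤ 3
    at-most = ℕ.≤-trans (∣p∪q∣≤∣p∣+∣q∣ ⁅ x ⁆ (⁅ y ⁆ ∪ ⁅ z ⁆))
                (ℕ.≤-trans (ℕ.+-monoʳ-≤ ∣ ⁅ x ⁆ ∣ (∣p∪q∣≤∣p∣+∣q∣ ⁅ y ⁆ ⁅ z ⁆))
                  (ℕ.≤-reflexive (cong₂ _+_ (∣⁅x⁆∣≡1 x) (cong₂ _+_ (∣⁅x⁆∣≡1 y) (∣⁅x⁆∣≡1 z)))))
    -- removing a member strictly lowers the size, and y survives removing x,
    -- z survives removing x and y: so three successive removals are strict
    at-least : 3 ≤ ∣ triple x y z ∣
    at-least = ℕ.<-≤-trans (s≤s (ℕ.<-≤-trans (s≤s (ℕ.<-≤-trans (s≤s z≤n)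
                 (x∈p⇒∣p-x∣<∣p∣ z∈−x−y))) (x∈p⇒∣p-x∣<∣p∣ y∈−x))) (x∈p⇒∣p-x∣<∣p∣ x∈)
      where
        y∈−x : y ∈ triple x y z - x
        y∈−x = x∈p∧x≢y⇒x∈p-y y∈ (λ e → x≢y (sym e))
        z∈−x−y : z ∈ triple x y z - x - y
        z∈−x−y = x∈p∧x≢y⇒x∈p-y (x∈p∧x≢y⇒x∈p-y z∈ (λ e → x≢z (sym e))) (λ e → y≢z (sym e))

module _ {A : Set} where

  three-distinct-in-pair : ∀ {b c y₁ y₂ y₃ : A} → (y₁ ≡ b ⊎ y₁ ≡ c) → (y₂ ≡ b ⊎ y₂ ≡ c) →
                           (y₃ ≡ b ⊎ y₃ ≡ c) → y₁ ≢ y₂ → y₁ ≢ y₃ → y₂ ≢ y₃ → ⊥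
  three-distinct-in-pair (inj₁ e₁) (inj₁ e₂) _ d₁₂ _ _ = d₁₂ (trans e₁ (sym e₂))
  three-distinct-in-pair (inj₂ e₁) (inj₂ e₂) _ d₁₂ _ _ = d₁₂ (trans e₁ (sym e₂))
  three-distinct-in-pair (inj₁ e₁) (inj₂ e₂) (inj₁ e₃) _ d₁₃ _ = d₁₃ (trans e₁ (sym e₃))
  three-distinct-in-pair (inj₁ e₁) (inj₂ e₂) (inj₂ e₃) _ _ d₂₃ = d₂₃ (trans e₂ (sym e₃))
  three-distinct-in-pair (inj₂ e₁) (inj₁ e₂) (inj₁ e₃) _ _ d₂₃ = d₂₃ (trans e₂ (sym e₃))
  three-distinct-in-pair (inj₂ e₁) (inj₁ e₂) (inj₂ e₃) _ d₁₃ _ = d₁₃ (trans e₁ (sym e₃))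

  without-a : ∀ {a b c x : A} → (x ≡ a ⊎ x ≡ b ⊎ x ≡ c) → x ≢ a → x ≡ b ⊎ x ≡ c
  without-a (inj₁ e) x≢a = ⊥-elim (x≢a e)
  without-a (inj₂ x∈bc) _ = x∈bc

  without-b : ∀ {a b c x : A} → (x ≡ a ⊎ x ≡ b ⊎ x ≡ c) → x ≢ b → x ≡ a ⊎ x ≡ c
  without-b (inj₁ e) _ = inj₁ e
  without-b (inj₂ (inj₁ e)) x≢b = ⊥-elim (x≢b e)
  without-b (inj₂ (inj₂ e)) _ = inj₂ e

  without-c : ∀ {a b c x : A} → (x ≡ a ⊎ x ≡ b ⊎ x ≡ c) → x ≢ c → x ≡ a ⊎ x ≡ b
  without-c (inj₁ e) _ = inj₁ e
  without-c (inj₂ (inj₁ e)) _ = inj₂ e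
  without-c (inj₂ (inj₂ e)) x≢c = ⊥-elim (x≢c e)

  ≢-by : ∀ {x y z : A} → x ≢ y → x ≡ z → y ≢ z
  ≢-by x≢y x≡z y≡z = x≢y (trans x≡z (sym y≡z))

  four-distinct-in-triple : ∀ {a b c x₁ x₂ x₃ x₄ : A} →
    (x₁ ≡ a ⊎ x₁ ≡ b ⊎ x₁ ≡ c) → (x₂ ≡ a ⊎ x₂ ≡ b ⊎ x₂ ≡ c) →
    (x₃ ≡ a ⊎ x₃ ≡ b ⊎ x₃ ≡ c) → (x₄ ≡ a ⊎ x₄ ≡ b ⊎ x₄ ≡ c) →
    x₁ ≢ x₂ → x₁ ≢ x₃ → x₁ ≢ x₄ → x₂ ≢ x₃ → x₂ ≢ x₄ → x₃ ≢ x₄ → ⊥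
  four-distinct-in-triple (inj₁ e) m₂ m₃ m₄ d₁₂ d₁₃ d₁₄ =
    three-distinct-in-pair (without-a m₂ (≢-by d₁₂ e)) (without-a m₃ (≢-by d₁₃ e)) (without-a m₄ (≢-by d₁₄ e))
  four-distinct-in-triple (inj₂ (inj₁ e)) m₂ m₃ m₄ d₁₂ d₁₃ d₁₄ =
    three-distinct-in-pair (without-b m₂ (≢-by d₁₂ e)) (without-b m₃ (≢-by d₁₃ e)) (without-b m₄ (≢-by d₁₄ e))
  four-distinct-in-triple (inj₂ (inj₂ e)) m₂ m₃ m₄ d₁₂ d₁₃ d₁₄ =
    three-distinct-in-pair (without-c m₂ (≢-by d₁₂ e)) (without-c m₃ (≢-by d₁₃ e)) (without-c m₄ (≢-by d₁₄ e))

-- The cycle ℤ/(k+6): iterated successor, predecessor, and small distinct shifts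

module Cycle (k : ℕ) where

  n : ℕ
  n = N k

  X : Set
  X = Fin n

  shift : ℕ → X → X
  shift zero x = x
  shift (suc d) x = next (shift d x)

  toℕ-next : ∀ x → toℕ (next x) ≡ suc (toℕ x) % n
  toℕ-next x = toℕ-fromℕ< _

  suc-% : ∀ m → suc (m % n) % n ≡ suc m % n
  suc-% m = trans (%-distribˡ-+ 1 (m % n) n)
              (trans (cong (λ r → (1 % n + r) % n) (m%n%n≡m%n m n)) (sym (%-distribˡ-+ 1 m n)))

  toℕ-shift : ∀ d x → toℕ (shift d x) ≡ (toℕ x + d) % n
  toℕ-shift zero x = trans (sym (m<n⇒m%n≡m (toℕ<n x))) (cong (_% n) (sym (ℕ.+-identityʳ (toℕ x))))
  toℕ-shift (suc d) x = begin
    toℕ (next (shift d x))    ≡⟨ toℕ-next (shift d x) ⟩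
    suc (toℕ (shift d x)) % n ≡⟨ cong (λ r → suc r % n) (toℕ-shift d x) ⟩
    suc ((toℕ x + d) % n) % n ≡⟨ suc-% (toℕ x + d) ⟩
    suc (toℕ x + d) % n       ≡⟨ cong (_% n) (sym (ℕ.+-suc (toℕ x) d)) ⟩
    (toℕ x + suc d) % n       ∎
    where open ≡-Reasoning

  reduce-once : ∀ m → m < n + n → m % n ≡ m ⊎ m % n + n ≡ m
  reduce-once m m<2n with m ℕ.<? n
  ... | yes m<n = inj₁ (m<n⇒m%n≡m m<n)
  ... | no m≮n = inj₂ (trans (cong (_+ n) m%n≡m∸n) (ℕ.m∸n+n≡m n≤m))
    where
      n≤m : n ≤ m
      n≤m = ℕ.≮⇒≥ m≮n
      m∸n<n : m ∸ n < n
      m∸n<n = ℕ.+-cancelʳ-< n (m ∸ n) n (subst (_< n + n) (sym (ℕ.m∸n+n≡m n≤m)) m<2n)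
      m%n≡m∸n : m % n ≡ m ∸ n
      m%n≡m∸n = trans (sym (m≤n⇒[n∸m]%m≡n%m n≤m)) (m<n⇒m%n≡m m∸n<n)

  same-residue : ∀ c i j → c < n → i < n → j < n → (c + i) % n ≡ (c + j) % n → i ≡ j
  same-residue c i j c<n i<n j<n same
    with reduce-once (c + i) (ℕ.+-mono-< c<n i<n) | reduce-once (c + j) (ℕ.+-mono-< c<n j<n)
  ... | inj₁ ri | inj₁ rj = ℕ.+-cancelˡ-≡ c i j (trans (sym ri) (trans same rj))
  ... | inj₂ ri | inj₂ rj = ℕ.+-cancelˡ-≡ c i j (trans (sym ri) (trans (cong (_+ n) same) rj))
  ... | inj₁ ri | inj₂ rj = ⊥-elim (ℕ.<⇒≱ j<n (subst (n ≤_) (sym j≡i+n) (ℕ.m≤n+m n i)))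
    where j≡i+n : j ≡ i + n
          j≡i+n = ℕ.+-cancelˡ-≡ c j (i + n)
                    (trans (sym rj) (trans (cong (_+ n) (trans (sym same) ri)) (ℕ.+-assoc c i n)))
  ... | inj₂ ri | inj₁ rj = ⊥-elim (ℕ.<⇒≱ i<n (subst (n ≤_) (sym i≡j+n) (ℕ.m≤n+m n j)))
    where i≡j+n : i ≡ j + n
          i≡j+n = ℕ.+-cancelˡ-≡ c i (j + n)
                    (trans (sym ri) (trans (cong (_+ n) (trans same rj)) (ℕ.+-assoc c j n)))

  shift-injective : ∀ {x} i j → i < n → j < n → shift i x ≡ shift j x → i ≡ j
  shift-injective {x} i j i<n j<n e = same-residue (toℕ x) i j (toℕ<n x) i<n j<n
    (trans (sym (toℕ-shift i x)) (trans (cong toℕ e) (toℕ-shift j x)))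

  -- Since n ≥ 6, the points x, x+1, …, x+5 are pairwise distinct.  The side conditions
  -- are decided by computation, so for numerals they are filled in automatically.
  shift-distinct : ∀ x i j → {T (i <ᵇ 6)} → {T (j <ᵇ 6)} → {False (i ℕ.≟ j)} → shift i x ≢ shift j x
  shift-distinct x i j {i<6} {j<6} {i≢j} e =
    toWitnessFalse i≢j (shift-injective i j (below-n i i<6) (below-n j j<6) e)
    where below-n : ∀ m → T (m <ᵇ 6) → m < n
          below-n m m<6 = ℕ.≤-trans (ℕ.<ᵇ⇒< m 6 m<6) (ℕ.m≤m+n 6 k)

  next≢id : ∀ x → next x ≢ x
  next≢id x = shift-distinct x 1 0

  shift-+ : ∀ i j x → shift i (shift j x) ≡ shift (i + j) x
  shift-+ zero j x = refl
  shift-+ (suc i) j x = cong next (shift-+ i j x)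

  shift-period : ∀ x → shift n x ≡ x
  shift-period x = toℕ-injective (trans (toℕ-shift n x)
                     (trans ([m+n]%n≡m%n (toℕ x) n) (m<n⇒m%n≡m (toℕ<n x))))

  prev-as-shift : ∀ x → prev x ≡ shift (5 + k) x
  prev-as-shift x = toℕ-injective (trans (toℕ-fromℕ< _) (sym (toℕ-shift (5 + k) x)))

  next-prev : ∀ x → next (prev x) ≡ x
  next-prev x = trans (cong next (prev-as-shift x)) (shift-period x)

  prev-next : ∀ x → prev (next x) ≡ x
  prev-next x = begin
    prev (next x)          ≡⟨ prev-as-shift (next x) ⟩
    shift (5 + k) (next x) ≡⟨ shift-+ (5 + k) 1 x ⟩
    shift (5 + k + 1) x    ≡⟨ cong (λ d → shift d x) (ℕ.+-comm (5 + k) 1) ⟩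
    shift n x              ≡⟨ shift-period x ⟩
    x                      ∎
    where open ≡-Reasoning

  next-injective : ∀ {x y} → next x ≡ next y → x ≡ y
  next-injective {x} {y} e = trans (sym (prev-next x)) (trans (cong prev e) (prev-next y))

  shift-from-prev : ∀ d x → shift (suc d) (prev x) ≡ shift d x
  shift-from-prev zero x = next-prev x
  shift-from-prev (suc d) x = cong next (shift-from-prev d x)

  -- Apartness of points: the relation between two elements of a stable vertex

  Apart : X → X → Set
  Apart x y = x ≢ y × next x ≢ y × next y ≢ x

  apart-sym : ∀ {x y} → Apart x y → Apart y x
  apart-sym (x≢y , x⁺≢y , y⁺≢x) = (λ e → x≢y (sym e)) , y⁺≢x , x⁺≢y

  -- The negation of apartness, stated positively.
  Close : X → X → Set
  Close x y = x ≡ y ⊎ next x ≡ y ⊎ next y ≡ x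

  apart-or-close : ∀ x y → Apart x y ⊎ Close x y
  apart-or-close x y with x ≟ y | next x ≟ y | next y ≟ x
  ... | yes e | _ | _ = inj₂ (inj₁ e)
  ... | no _ | yes e | _ = inj₂ (inj₂ (inj₁ e))
  ... | no _ | no _ | yes e = inj₂ (inj₂ (inj₂ e))
  ... | no x≢y | no x⁺≢y | no y⁺≢x = inj₁ (x≢y , x⁺≢y , y⁺≢x)

  apart-shift : ∀ x i j → {T (i <ᵇ 6)} → {T (j <ᵇ 6)} → {T (suc i <ᵇ 6)} → {T (suc j <ᵇ 6)} →
                {False (i ℕ.≟ j)} → {False (suc i ℕ.≟ j)} → {False (suc j ℕ.≟ i)} →
                Apart (shift i x) (shift j x)
  apart-shift x i j {i<6} {j<6} {i⁺<6} {j⁺<6} {i≢j} {i⁺≢j} {j⁺≢i} =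
    shift-distinct x i j {i<6} {j<6} {i≢j} ,
    shift-distinct x (suc i) j {i⁺<6} {j<6} {i⁺≢j} ,
    shift-distinct x (suc j) i {j⁺<6} {i<6} {j⁺≢i}

  NoApartTriple : (X → Set) → Set
  NoApartTriple C = ∀ x y z → C x → C y → C z → Apart x y → Apart y z → Apart x z → ⊥

  -- The two shapes of the decomposition: {s, s+1, t} and {p, p+1, q, q+1}

  AForm : X → X → X → Set
  AForm s t x = x ≡ s ⊎ x ≡ next s ⊎ x ≡ t

  BForm : X → X → X → Set
  BForm p q x = x ≡ p ⊎ x ≡ next p ⊎ x ≡ q ⊎ x ≡ next q

  BForm-swap : ∀ {p q x} → BForm p q x → BForm q p x
  BForm-swap (inj₁ e) = inj₂ (inj₂ (inj₁ e))
  BForm-swap (inj₂ (inj₁ e)) = inj₂ (inj₂ (inj₂ e))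
  BForm-swap (inj₂ (inj₂ (inj₁ e))) = inj₁ e
  BForm-swap (inj₂ (inj₂ (inj₂ e))) = inj₂ (inj₁ e)

  data Shape (C : X → Set) : Set where
    a-shape : ∀ s t → InI s t → (∀ x → C x ⇔ AForm s t x) → Shape C
    b-shape : ∀ p q → InI p q → (∀ x → C x ⇔ BForm p q x) → Shape C

  mk-a-shape : ∀ {C : X → Set} {s t} → InI s t → C s → C (next s) → C t →
               (∀ x → C x → AForm s t x) → Shape C
  mk-a-shape {C} {s} {t} I cs cs⁺ ct C⊆ = a-shape s t I (λ x → mk⇔ (C⊆ x) (⊆C x))
    where ⊆C : ∀ x → AForm s t x → C x
          ⊆C x (inj₁ refl) = cs
          ⊆C x (inj₂ (inj₁ refl)) = cs⁺
          ⊆C x (inj₂ (inj₂ refl)) = ct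

  mk-b-shape : ∀ {C : X → Set} {p q} → InI p q → C p → C (next p) → C q → C (next q) →
               (∀ x → C x → BForm p q x) → Shape C
  mk-b-shape {C} {p} {q} I cp cp⁺ cq cq⁺ C⊆ = b-shape p q I (λ x → mk⇔ (C⊆ x) (⊆C x))
    where ⊆C : ∀ x → BForm p q x → C x
          ⊆C x (inj₁ refl) = cp
          ⊆C x (inj₂ (inj₁ refl)) = cp⁺
          ⊆C x (inj₂ (inj₂ (inj₁ refl))) = cq
          ⊆C x (inj₂ (inj₂ (inj₂ refl))) = cq⁺

  -- Membership t ∈ I_s, with the condition t ≠ s−1 stated as t+1 ≠ s.
  InI-intro : ∀ {p q} → next q ≢ p → q ≢ p → q ≢ next p → InI p q
  InI-intro {p} {q} q⁺≢p q≢p q≢p⁺ =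
    (λ e → q⁺≢p (trans (cong next e) (next-prev p))) , q≢p , q≢p⁺

  -- t ∈ I_s is a symmetric relation (distance ≥ 2 in the cycle).
  InI-sym : ∀ {s u} → InI s u → InI u s
  InI-sym {s} {u} (u≢s⁻ , u≢s , u≢s⁺) =
    (λ e → u≢s⁺ (trans (sym (next-prev u)) (sym (cong next e)))) ,
    (λ e → u≢s (sym e)) ,
    (λ e → u≢s⁻ (trans (sym (prev-next u)) (cong prev (sym e))))

  -- a−1 ≠ a+2, as n ≠ 3.
  prev≢next² : ∀ a → prev a ≢ next (next a)
  prev≢next² a e = shift-distinct (prev a) 0 3 (trans e (sym (shift-from-prev 2 a)))

  InI-prev-next : ∀ a → InI (prev a) (next a)
  InI-prev-next a = InI-intro (λ e → prev≢next² a (sym e))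
    (λ e → shift-distinct (prev a) 2 0 (trans (shift-from-prev 1 a) e))
    (λ e → next≢id a (trans e (next-prev a)))

  -- The points of C outside {a, a+1} (the rest) are pairwise close, except for the
  -- pair a−1, a+2 which makes C the run {a−1, …, a+2}; otherwise the rest lies in a
  -- consecutive pair {d, d+1}, which gives the shapes {a, a+1, d+1} / {a, a+1, d, d+1}.
  module Classification (C : X → Set) (C? : ∀ x → Dec (C x)) (no-triple : NoApartTriple C)
                        (a : X) (ca : C a) (ca⁺ : C (next a)) where

    Rest : X → Set
    Rest x = C x × x ≢ a × x ≢ next a

    rest? : ∀ x → Dec (Rest x)
    rest? x = C? x ×-dec (¬? (x ≟ a) ×-dec ¬? (x ≟ next a))

    pair-or-rest : ∀ x → C x → x ≡ a ⊎ x ≡ next a ⊎ Rest x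
    pair-or-rest x cx with x ≟ a | x ≟ next a
    ... | yes e | _ = inj₁ e
    ... | no _ | yes e = inj₂ (inj₁ e)
    ... | no x≢a | no x≢a⁺ = inj₂ (inj₂ (cx , x≢a , x≢a⁺))

    apart-a : ∀ {x} → Rest x → Apart a x ⊎ x ≡ prev a
    apart-a {x} (_ , x≢a , x≢a⁺) with apart-or-close a x
    ... | inj₁ a∥x = inj₁ a∥x
    ... | inj₂ (inj₁ e) = ⊥-elim (x≢a (sym e))
    ... | inj₂ (inj₂ (inj₁ e)) = ⊥-elim (x≢a⁺ (sym e))
    ... | inj₂ (inj₂ (inj₂ e)) = inj₂ (trans (sym (prev-next x)) (cong prev e))

    apart-a⁺ : ∀ {x} → Rest x → Apart (next a) x ⊎ x ≡ next (next a)
    apart-a⁺ {x} (_ , x≢a , x≢a⁺) with apart-or-close (next a) x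
    ... | inj₁ a⁺∥x = inj₁ a⁺∥x
    ... | inj₂ (inj₁ e) = ⊥-elim (x≢a⁺ (sym e))
    ... | inj₂ (inj₂ (inj₁ e)) = inj₂ (sym e)
    ... | inj₂ (inj₂ (inj₂ e)) = ⊥-elim (x≢a (next-injective e))

    rest-close : ∀ {x y} → Rest x → Rest y →
                 Close x y ⊎ (x ≡ prev a × y ≡ next (next a)) ⊎ (y ≡ prev a × x ≡ next (next a))
    rest-close {x} {y} rx ry with apart-or-close x y
    ... | inj₂ x~y = inj₁ x~y
    ... | inj₁ x∥y with apart-a rx | apart-a ry | apart-a⁺ rx | apart-a⁺ ry
    ... | inj₁ a∥x | inj₁ a∥y | _ | _ = ⊥-elim (no-triple a x y ca (proj₁ rx) (proj₁ ry) a∥x x∥y a∥y)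
    ... | _ | _ | inj₁ a⁺∥x | inj₁ a⁺∥y =
      ⊥-elim (no-triple (next a) x y ca⁺ (proj₁ rx) (proj₁ ry) a⁺∥x x∥y a⁺∥y)
    ... | inj₂ x≡a⁻ | _ | _ | inj₂ y≡a⁺⁺ = inj₂ (inj₁ (x≡a⁻ , y≡a⁺⁺))
    ... | _ | inj₂ y≡a⁻ | inj₂ x≡a⁺⁺ | _ = inj₂ (inj₂ (y≡a⁻ , x≡a⁺⁺))
    ... | inj₂ x≡a⁻ | _ | inj₂ x≡a⁺⁺ | _ = ⊥-elim (prev≢next² a (trans (sym x≡a⁻) x≡a⁺⁺))
    ... | _ | inj₂ y≡a⁻ | _ | inj₂ y≡a⁺⁺ = ⊥-elim (prev≢next² a (trans (sym y≡a⁻) y≡a⁺⁺))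

    -- If a−1 and a+2 are in C, then C is the run {a−1, a, a+1, a+2}: any further point
    -- x would be apart from a−1 and a+1, or be a−2, which is apart from a and a+2.
    run-of-four : C (prev a) → C (next (next a)) → Shape C
    run-of-four ca⁻ ca⁺⁺ = mk-b-shape (InI-prev-next a) ca⁻ (subst C (sym (next-prev a)) ca) ca⁺ ca⁺⁺ C⊆
      where
        a⁻∥a⁺ : Apart (prev a) (next a)
        a⁻∥a⁺ = subst (Apart (prev a)) (shift-from-prev 1 a) (apart-shift (prev a) 0 2)
        a−2-excluded : ∀ {x} → C x → Apart a x → next x ≡ prev a → ⊥
        a−2-excluded {x} cx a∥x x⁺≡a⁻ =
          no-triple x a (next (next a)) cx ca ca⁺⁺ (apart-sym a∥x) (apart-shift a 0 2)
            (subst (Apart x) (sym (cong (λ y → next (next y)) a≡x⁺⁺)) (apart-shift x 0 4))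
          where a≡x⁺⁺ : a ≡ shift 2 x
                a≡x⁺⁺ = trans (sym (next-prev a)) (cong next (sym x⁺≡a⁻))
        no-further-point : ∀ {x} → Rest x → x ≢ prev a → x ≢ next (next a) → ⊥
        no-further-point {x} rx x≢a⁻ x≢a⁺⁺ with apart-a rx | apart-a⁺ rx
        ... | inj₂ e | _ = x≢a⁻ e
        ... | _ | inj₂ e = x≢a⁺⁺ e
        ... | inj₁ a∥x | inj₁ a⁺∥x with apart-or-close (prev a) x
        ...   | inj₁ a⁻∥x = no-triple (prev a) (next a) x ca⁻ ca⁺ (proj₁ rx) a⁻∥a⁺ a⁺∥x a⁻∥x
        ...   | inj₂ (inj₁ e) = x≢a⁻ (sym e)
        ...   | inj₂ (inj₂ (inj₁ e)) = proj₁ (proj₂ rx) (trans (sym e) (next-prev a))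
        ...   | inj₂ (inj₂ (inj₂ e)) = a−2-excluded (proj₁ rx) a∥x e
        C⊆ : ∀ x → C x → BForm (prev a) (next a) x
        C⊆ x cx with pair-or-rest x cx
        ... | inj₁ e = inj₂ (inj₁ (trans e (sym (next-prev a))))
        ... | inj₂ (inj₁ e) = inj₂ (inj₂ (inj₁ e))
        ... | inj₂ (inj₂ rx) with x ≟ prev a | x ≟ next (next a)
        ...   | yes e | _ = inj₁ e
        ...   | no _ | yes e = inj₂ (inj₂ (inj₂ e))
        ...   | no x≢a⁻ | no x≢a⁺⁺ = ⊥-elim (no-further-point rx x≢a⁻ x≢a⁺⁺)

    rest-clique : ¬ (C (prev a) × C (next (next a))) → ∀ {x y} → Rest x → Rest y → Close x y
    rest-clique ¬both rx ry with rest-close rx ry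
    ... | inj₁ x~y = x~y
    ... | inj₂ (inj₁ (refl , refl)) = ⊥-elim (¬both (proj₁ rx , proj₁ ry))
    ... | inj₂ (inj₂ (refl , refl)) = ⊥-elim (¬both (proj₁ ry , proj₁ rx))

    -- ... so the rest lies in a consecutive pair {d, d+1} with d in the rest:
    -- take d = b−1 if that is in the rest and d = b otherwise.
    rest-in-pair : ¬ (C (prev a) × C (next (next a))) → ∀ {b} → Rest b →
                   Σ X λ d → Rest d × (∀ x → Rest x → x ≡ d ⊎ x ≡ next d)
    rest-in-pair ¬both {b} rb with rest? (prev b)
    ... | yes rb⁻ = prev b , rb⁻ , λ x rx → around-b⁻ (rest-clique ¬both rx rb) (rest-clique ¬both rx rb⁻)
      where
        around-b⁻ : ∀ {x} → Close x b → Close x (prev b) → x ≡ prev b ⊎ x ≡ next (prev b)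
        around-b⁻ (inj₁ x≡b) _ = inj₂ (trans x≡b (sym (next-prev b)))
        around-b⁻ {x} (inj₂ (inj₁ x⁺≡b)) _ = inj₁ (trans (sym (prev-next x)) (cong prev x⁺≡b))
        around-b⁻ (inj₂ (inj₂ b⁺≡x)) (inj₁ x≡b⁻) =
          ⊥-elim (shift-distinct (prev b) 2 0 (trans (shift-from-prev 1 b) (trans b⁺≡x x≡b⁻)))
        around-b⁻ (inj₂ (inj₂ b⁺≡x)) (inj₂ (inj₁ x⁺≡b⁻)) =
          ⊥-elim (shift-distinct (prev b) 3 0 (trans (shift-from-prev 2 b) (trans (cong next b⁺≡x) x⁺≡b⁻)))
        around-b⁻ (inj₂ (inj₂ b⁺≡x)) (inj₂ (inj₂ b⁻⁺≡x)) =
          ⊥-elim (next≢id b (trans b⁺≡x (trans (sym b⁻⁺≡x) (next-prev b))))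
    ... | no ¬rb⁻ = b , rb , λ x rx → around-b rx (rest-clique ¬both rx rb)
      where
        around-b : ∀ {x} → Rest x → Close x b → x ≡ b ⊎ x ≡ next b
        around-b _ (inj₁ x≡b) = inj₁ x≡b
        around-b {x} rx (inj₂ (inj₁ x⁺≡b)) = ⊥-elim (¬rb⁻ (subst Rest x≡b⁻ rx))
          where x≡b⁻ : x ≡ prev b
                x≡b⁻ = trans (sym (prev-next x)) (cong prev x⁺≡b)
        around-b _ (inj₂ (inj₂ b⁺≡x)) = inj₂ (sym b⁺≡x)

    -- With the rest inside {d, d+1}: C = {a, a+1, d, d+1} if d+1 is in the rest;
    -- otherwise C = {a, a+1, d}, written {a−1, a, a+1} when d = a−1.
    from-pair : (Σ X λ d → Rest d × (∀ x → Rest x → x ≡ d ⊎ x ≡ next d)) → Shape C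
    from-pair (d , rd@(cd , d≢a , d≢a⁺) , rest⊆) with rest? (next d)
    ... | yes rd⁺@(cd⁺ , d⁺≢a , _) = mk-b-shape (InI-intro d⁺≢a d≢a d≢a⁺) ca ca⁺ cd cd⁺ C⊆
      where
        C⊆ : ∀ x → C x → BForm a d x
        C⊆ x cx with pair-or-rest x cx
        ... | inj₁ e = inj₁ e
        ... | inj₂ (inj₁ e) = inj₂ (inj₁ e)
        ... | inj₂ (inj₂ rx) = inj₂ (inj₂ (rest⊆ x rx))
    ... | no ¬rd⁺ with d ≟ prev a
    ...   | yes d≡a⁻ = mk-a-shape (InI-prev-next a) (subst C d≡a⁻ cd) (subst C (sym (next-prev a)) ca) ca⁺ C⊆
      where
        C⊆ : ∀ x → C x → AForm (prev a) (next a) x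
        C⊆ x cx with pair-or-rest x cx
        ... | inj₁ e = inj₂ (inj₁ (trans e (sym (next-prev a))))
        ... | inj₂ (inj₁ e) = inj₂ (inj₂ e)
        ... | inj₂ (inj₂ rx) with rest⊆ x rx
        ...   | inj₁ x≡d = inj₁ (trans x≡d d≡a⁻)
        ...   | inj₂ x≡d⁺ = ⊥-elim (¬rd⁺ (subst Rest x≡d⁺ rx))
    ...   | no d≢a⁻ = mk-a-shape (InI-intro d⁺≢a d≢a d≢a⁺) ca ca⁺ cd C⊆
      where
        d⁺≢a : next d ≢ a
        d⁺≢a e = d≢a⁻ (trans (sym (prev-next d)) (cong prev e))
        C⊆ : ∀ x → C x → AForm a d x
        C⊆ x cx with pair-or-rest x cx
        ... | inj₁ e = inj₁ e
        ... | inj₂ (inj₁ e) = inj₂ (inj₁ e)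
        ... | inj₂ (inj₂ rx) with rest⊆ x rx
        ...   | inj₁ x≡d = inj₂ (inj₂ x≡d)
        ...   | inj₂ x≡d⁺ = ⊥-elim (¬rd⁺ (subst Rest x≡d⁺ rx))

    classify : ∀ {b} → Rest b → Shape C
    classify rb with C? (prev a) ×-dec C? (next (next a))
    ... | yes (ca⁻ , ca⁺⁺) = run-of-four ca⁻ ca⁺⁺
    ... | no ¬both = from-pair (rest-in-pair ¬both rb)

  -- Rigidity: the index data of a shape is determined by the set of points

  a-rigid : ∀ {s t s' t'} → InI s t → InI s' t' → (∀ x → AForm s' t' x → AForm s t x) →
            (∀ x → AForm s t x → AForm s' t' x) → s' ≡ s × t' ≡ t
  a-rigid {s' = s'} {t'} _ (_ , t'≢s' , t'≢s'⁺) F G with F s' (inj₁ refl)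
  ... | inj₁ s'≡s with F t' (inj₂ (inj₂ refl))
  ...   | inj₁ e = ⊥-elim (t'≢s' (trans e (sym s'≡s)))
  ...   | inj₂ (inj₁ e) = ⊥-elim (t'≢s'⁺ (trans e (cong next (sym s'≡s))))
  ...   | inj₂ (inj₂ t'≡t) = s'≡s , t'≡t
  -- s' = s+1 would force t = s+2 and then s ∉ {s+1, s+2, t'}
  a-rigid {s} {t} {s'} {t'} _ (t'≢s'⁻ , _ , _) F G | inj₂ (inj₁ refl) with F (next (next s)) (inj₂ (inj₁ refl))
  ... | inj₁ e = ⊥-elim (shift-distinct s 2 0 e)
  ... | inj₂ (inj₁ e) = ⊥-elim (next≢id (next s) e)
  ... | inj₂ (inj₂ _) with G s (inj₁ refl)
  ...   | inj₁ e = ⊥-elim (next≢id s (sym e))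
  ...   | inj₂ (inj₁ e) = ⊥-elim (shift-distinct s 0 2 e)
  ...   | inj₂ (inj₂ s≡t') = ⊥-elim (t'≢s'⁻ (trans (sym s≡t') (sym (prev-next s))))
  -- s' = t would put t+1 into {s, s+1, t}
  a-rigid {s} {t} (t≢s⁻ , t≢s , _) _ F G | inj₂ (inj₂ refl) with F (next t) (inj₂ (inj₁ refl))
  ... | inj₁ e = ⊥-elim (t≢s⁻ (trans (sym (prev-next t)) (cong prev e)))
  ... | inj₂ (inj₁ e) = ⊥-elim (t≢s (next-injective e))
  ... | inj₂ (inj₂ e) = ⊥-elim (next≢id t e)

  b-aligned : ∀ {s u u'} → InI s u → InI s u' → (∀ x → BForm s u' x → BForm s u x) → u' ≡ u
  b-aligned {s} {u} {u'} _ (u'≢s⁻ , u'≢s , u'≢s⁺) F with F u' (inj₂ (inj₂ (inj₁ refl)))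
  ... | inj₁ e = ⊥-elim (u'≢s e)
  ... | inj₂ (inj₁ e) = ⊥-elim (u'≢s⁺ e)
  ... | inj₂ (inj₂ (inj₁ u'≡u)) = u'≡u
  ... | inj₂ (inj₂ (inj₂ u'≡u⁺)) with F (next u') (inj₂ (inj₂ (inj₂ refl)))
  ...   | inj₁ e = ⊥-elim (u'≢s⁻ (trans (sym (prev-next u')) (cong prev e)))
  ...   | inj₂ (inj₁ e) = ⊥-elim (u'≢s (next-injective e))
  ...   | inj₂ (inj₂ (inj₁ e)) = ⊥-elim (shift-distinct u 2 0 (trans (cong next (sym u'≡u⁺)) e))
  ...   | inj₂ (inj₂ (inj₂ e)) = ⊥-elim (next≢id u (trans (sym u'≡u⁺) (next-injective e)))

  -- A B-form starting at s+1 never lies inside a B-form starting at s: this would force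
  -- u = s+2, u' = s+3, and then s+4 ∈ {s, s+1, s+2, s+3}, impossible as n ≥ 6.
  b-not-shifted : ∀ {s u u'} → InI s u → InI (next s) u' → (∀ x → BForm (next s) u' x → BForm s u x) → ⊥
  b-not-shifted {s} {u} {u'} (_ , _ , u≢s⁺) (u'≢s , u'≢s⁺ , u'≢s⁺⁺) F
    with F (next (next s)) (inj₂ (inj₁ refl))
  ... | inj₁ e = shift-distinct s 2 0 e
  ... | inj₂ (inj₁ e) = next≢id (next s) e
  ... | inj₂ (inj₂ (inj₂ e)) = u≢s⁺ (sym (next-injective e))
  ... | inj₂ (inj₂ (inj₁ s⁺⁺≡u)) with F u' (inj₂ (inj₂ (inj₁ refl)))
  ...   | inj₁ e = u'≢s (trans e (sym (prev-next s)))
  ...   | inj₂ (inj₁ e) = u'≢s⁺ e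
  ...   | inj₂ (inj₂ (inj₁ e)) = u'≢s⁺⁺ (trans e (sym s⁺⁺≡u))
  ...   | inj₂ (inj₂ (inj₂ u'≡u⁺)) = s+4-outside (F (next u') (inj₂ (inj₂ (inj₂ refl))))
    where
      u≡s+2 : u ≡ shift 2 s
      u≡s+2 = sym s⁺⁺≡u
      u'⁺≡s+4 : next u' ≡ shift 4 s
      u'⁺≡s+4 = cong next (trans u'≡u⁺ (cong next u≡s+2))
      s+4-outside : BForm s u (next u') → ⊥
      s+4-outside (inj₁ e) = shift-distinct s 4 0 (trans (sym u'⁺≡s+4) e)
      s+4-outside (inj₂ (inj₁ e)) = shift-distinct s 4 1 (trans (sym u'⁺≡s+4) e)
      s+4-outside (inj₂ (inj₂ (inj₁ e))) = shift-distinct s 4 2 (trans (sym u'⁺≡s+4) (trans e u≡s+2))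
      s+4-outside (inj₂ (inj₂ (inj₂ e))) =
        shift-distinct s 4 3 (trans (sym u'⁺≡s+4) (trans e (cong next u≡s+2)))

  b-rigid : ∀ {s u s' u'} → InI s u → InI s' u' → (∀ x → BForm s' u' x → BForm s u x) →
            (s' ≡ s × u' ≡ u) ⊎ (s' ≡ u × u' ≡ s)
  b-rigid {s' = s'} I I' F with F s' (inj₁ refl)
  ... | inj₁ refl = inj₁ (refl , b-aligned I I' F)
  ... | inj₂ (inj₁ refl) = ⊥-elim (b-not-shifted I I' F)
  ... | inj₂ (inj₂ (inj₁ refl)) = inj₂ (refl , b-aligned (InI-sym I) I' (λ x → BForm-swap ∘′ F x))
  ... | inj₂ (inj₂ (inj₂ refl)) = ⊥-elim (b-not-shifted (InI-sym I) I' (λ x → BForm-swap ∘′ F x))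

  -- The four points of a B-form are distinct, so a B-form never lies inside an A-form.
  b-not-in-a : ∀ {p q s t} → InI p q → (∀ x → BForm p q x → AForm s t x) → ⊥
  b-not-in-a {p} {q} (q≢p⁻ , q≢p , q≢p⁺) F =
    four-distinct-in-triple (F p (inj₁ refl)) (F (next p) (inj₂ (inj₁ refl)))
      (F q (inj₂ (inj₂ (inj₁ refl)))) (F (next q) (inj₂ (inj₂ (inj₂ refl))))
      (λ e → next≢id p (sym e)) (λ e → q≢p (sym e))
      (λ e → q≢p⁻ (trans (sym (prev-next q)) (cong prev (sym e))))
      (λ e → q≢p⁺ (sym e)) (λ e → q≢p (sym (next-injective e))) (λ e → next≢id q (sym e))

  -- Normalising the indices of a B-form: the unordered pair {p, q} with q ∈ I_p
  -- corresponds to exactly one admissible index (s, u) with s ∈ [k+4], u ∈ J_s.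

  Ordered : X → X → Set
  Ordered s u = (toℕ s < k + 4) × InJ s u

  toℕ≤k+5 : ∀ x → toℕ x ≤ k + 5
  toℕ≤k+5 x = subst (toℕ x ≤_) (ℕ.+-comm 5 k) (s≤s⁻¹ (toℕ<n x))

  toℕ-next-below : ∀ x → toℕ x < k + 5 → toℕ (next x) ≡ suc (toℕ x)
  toℕ-next-below x x<k+5 = trans (toℕ-next x) (m<n⇒m%n≡m (s≤s (subst (toℕ x <_) (ℕ.+-comm k 5) x<k+5)))

  toℕ-next-top : ∀ x → toℕ x ≡ k + 5 → toℕ (next x) ≡ 0
  toℕ-next-top x x≡k+5 = trans (toℕ-next x) (trans (cong (λ m → suc m % n) (trans x≡k+5 (ℕ.+-comm k 5))) (n%n≡0 n))

  k+5≡1+k+4 : k + 5 ≡ suc (k + 4)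
  k+5≡1+k+4 = ℕ.+-suc k 4

  ordered-gap : ∀ {s u} → Ordered s u → suc (suc (toℕ s)) ≤ toℕ u
  ordered-gap {s} {u} (_ , inj₁ (s≡0 , 3≤u , _)) =
    subst (λ m → suc (suc m) ≤ toℕ u) (sym (ℕ.suc-injective s≡0)) (s≤s⁻¹ 3≤u)
  ordered-gap (_ , inj₂ (_ , _ , s+2<u)) = s≤s⁻¹ s+2<u

  ordered-asym : ∀ {s u} → Ordered s u → Ordered u s → ⊥
  ordered-asym {s} {u} su us = ℕ.<⇒≱ (ℕ.≤-trans (ℕ.n≤1+n _) (ordered-gap su))
    (ℕ.≤-trans (ℕ.n≤1+n _) (ℕ.≤-trans (ℕ.n≤1+n _) (ordered-gap us)))

  -- Admissible B-indices are two points at cyclic distance ≥ 2; the wrap-around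
  -- u = s−1 is excluded by J_1 = {3, …, k+5}.
  ordered⇒InI : ∀ {s u} → Ordered s u → InI s u
  ordered⇒InI {s} {u} su@(s<k+4 , u∈J) = u≢s⁻ , u≢s , u≢s⁺
    where
      gap : suc (suc (toℕ s)) ≤ toℕ u
      gap = ordered-gap su
      s<k+5 : toℕ s < k + 5
      s<k+5 = ℕ.≤-trans s<k+4 (ℕ.≤-trans (ℕ.n≤1+n _) (ℕ.≤-reflexive (sym k+5≡1+k+4)))
      u≢s : u ≢ s
      u≢s e = ℕ.<⇒≢ (ℕ.<-trans (ℕ.n<1+n _) gap) (sym (cong toℕ e))
      u≢s⁺ : u ≢ next s
      u≢s⁺ e = ℕ.<⇒≢ gap (sym (trans (cong toℕ e) (toℕ-next-below s s<k+5)))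
      u≢s⁻ : u ≢ prev s
      u≢s⁻ e with ℕ.m≤n⇒m<n∨m≡n (toℕ≤k+5 u)
      ... | inj₁ u<k+5 = ℕ.<⇒≢ (ℕ.<-trans (ℕ.n<1+n _) (ℕ.<-trans gap (ℕ.n<1+n _)))
                           (sym (trans (sym (toℕ-next-below u u<k+5)) (cong toℕ u⁺≡s)))
        where u⁺≡s : next u ≡ s
              u⁺≡s = trans (cong next e) (next-prev s)
      ... | inj₂ u≡k+5 = wraps u∈J
        where
          s≡0 : toℕ s ≡ 0
          s≡0 = trans (sym (cong toℕ (trans (cong next e) (next-prev s)))) (toℕ-next-top u u≡k+5)
          wraps : InJ s u → ⊥
          wraps (inj₁ (_ , _ , u<k+5)) = ℕ.<⇒≢ u<k+5 u≡k+5
          wraps (inj₂ (1<s , _ , _)) = ℕ.<⇒≢ 1<s (cong suc (sym s≡0))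

  InI⇒ordered : ∀ {p q} → InI p q → toℕ p < toℕ q → Ordered p q
  InI⇒ordered {p} {q} (q≢p⁻ , _ , q≢p⁺) p<q = p<k+4 , in-J (toℕ p) refl
    where
      p<k+5 : toℕ p < k + 5
      p<k+5 = ℕ.<-≤-trans p<q (toℕ≤k+5 q)
      gap : suc (suc (toℕ p)) ≤ toℕ q
      gap = ℕ.≤∧≢⇒< p<q (λ e → q≢p⁺ (toℕ-injective (trans (sym e) (sym (toℕ-next-below p p<k+5)))))
      p<k+4 : toℕ p < k + 4
      p<k+4 = s≤s⁻¹ (ℕ.≤-trans gap (ℕ.≤-trans (toℕ≤k+5 q) (ℕ.≤-reflexive k+5≡1+k+4)))
      in-J : ∀ m → toℕ p ≡ m → InJ p q
      in-J zero p≡0 = inj₁ (cong suc p≡0 , s≤s (subst (λ m → suc (suc m) ≤ toℕ q) p≡0 gap) , q<k+5)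
        where
          q<k+5 : suc (toℕ q) ≤ k + 5
          q<k+5 with ℕ.m≤n⇒m<n∨m≡n (toℕ≤k+5 q)
          ... | inj₁ q<k+5 = q<k+5
          ... | inj₂ q≡k+5 = ⊥-elim (q≢p⁻ (trans (sym (prev-next q))
                               (cong prev (toℕ-injective (trans (toℕ-next-top q q≡k+5) (sym p≡0))))))
      in-J (suc m) p≡1+m = inj₂ (subst (λ i → 1 < suc i) (sym p≡1+m) (s≤s (s≤s z≤n)) ,
                                 ℕ.≤-trans (s≤s p<k+4) (ℕ.≤-reflexive (sym k+5≡1+k+4)) ,
                                 s≤s gap)

  orient : ∀ {p q} → InI p q → Ordered p q ⊎ Ordered q p
  orient {p} {q} I with ℕ.<-cmp (toℕ p) (toℕ q)
  ... | tri< p<q _ _ = inj₁ (InI⇒ordered I p<q)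
  ... | tri≈ _ p≡q _ = ⊥-elim (proj₁ (proj₂ I) (toℕ-injective (sym p≡q)))
  ... | tri> _ _ q<p = inj₂ (InI⇒ordered (InI-sym I) q<p)

module Neighbourhood (k : ℕ) where

  open Cycle k

  -- A vertex is a subset of size three, so a search over all subsets decides
  -- any decidable property of vertices.
  any-vertex? : (Q : Vertex k → Set) → (∀ v → Dec (Q v)) → Dec (∃ Q)
  any-vertex? Q Q? with anySubset? {P = λ p → Σ (∣ p ∣ ≡ 3) λ e → Q (p , e)} sized?
    where
      sized? : ∀ p → Dec (Σ (∣ p ∣ ≡ 3) λ e → Q (p , e))
      sized? p with ∣ p ∣ ℕ.≟ 3
      ... | no ∣p∣≢3 = no (λ (e , _) → ∣p∣≢3 e)
      ... | yes e with Q? (p , e)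
      ...   | yes q = yes (e , q)
      ...   | no ¬q = no (λ (e' , q') → ¬q (subst (λ e'' → Q (p , e'')) (ℕ.≡-irrelevant e' e) q'))
  ... | yes (p , e , q) = yes ((p , e) , q)
  ... | no ¬q = no (λ ((p , e) , q) → ¬q (p , e , q))

  unstable? : ∀ (v : Vertex k) → Dec (Unstable v)
  unstable? v = any? (λ t → (t ∈? elems v) ×-dec (next t ∈? elems v))

  inC? : ∀ (σ : VSet k) x → Dec (InC σ x)
  inC? σ x with any-vertex? (λ v → v ∈V σ × x ∈ elems v) (λ v → T? (σ v) ×-dec (x ∈? elems v))
  ... | yes (v , v∈σ , x∈v) = no (λ x∈C → x∈C v v∈σ x∈v)
  ... | no ¬x∈σ = yes (λ v v∈σ x∈v → ¬x∈σ (v , v∈σ , x∈v))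

  third-point : (w : Vertex k) → ∀ t → Σ X λ b → b ∈ elems w × b ≢ t × b ≢ next t
  third-point w t with any? (λ b → (b ∈? elems w) ×-dec (¬? (b ≟ t) ×-dec ¬? (b ≟ next t)))
  ... | yes found = found
  ... | no ¬found = ⊥-elim (three-not-in-pair (elems w) t (next t) (proj₂ w) in-pair)
    where
      in-pair : ∀ x → x ∈ elems w → x ≡ t ⊎ x ≡ next t
      in-pair x x∈w with x ≟ t | x ≟ next t
      ... | yes e | _ = inj₁ e
      ... | no _ | yes e = inj₂ e
      ... | no x≢t | no x≢t⁺ = ⊥-elim (¬found (x , x∈w , x≢t , x≢t⁺))

  stable-vertex : ∀ x y z → Apart x y → Apart y z → Apart x z →
                  Σ (Vertex k) λ w → Stable w × (∀ u → u ∈ elems w → u ≡ x ⊎ u ≡ y ⊎ u ≡ z)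
  stable-vertex x y z x∥y y∥z x∥z = w , stable , λ u → triple-members x y z
    where
      w : Vertex k
      w = triple x y z , triple-size x y z (proj₁ x∥y) (proj₁ x∥z) (proj₁ y∥z)
      -- t and t+1 would be two of x, y, z, but consecutive ones are never apart
      stable : Stable w
      stable (t , t∈ , t⁺∈) with triple-members x y z t∈ | triple-members x y z t⁺∈
      ... | inj₁ refl | inj₁ e = next≢id t e
      ... | inj₁ refl | inj₂ (inj₁ e) = proj₁ (proj₂ x∥y) e
      ... | inj₁ refl | inj₂ (inj₂ e) = proj₁ (proj₂ x∥z) e
      ... | inj₂ (inj₁ refl) | inj₁ e = proj₂ (proj₂ x∥y) e
      ... | inj₂ (inj₁ refl) | inj₂ (inj₁ e) = next≢id t e
      ... | inj₂ (inj₁ refl) | inj₂ (inj₂ e) = proj₁ (proj₂ y∥z) e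
      ... | inj₂ (inj₂ refl) | inj₁ e = proj₂ (proj₂ x∥z) e
      ... | inj₂ (inj₂ refl) | inj₂ (inj₁ e) = proj₂ (proj₂ y∥z) e
      ... | inj₂ (inj₂ refl) | inj₂ (inj₂ e) = next≢id t e

  AllUnstable : (X → Set) → Set
  AllUnstable F = ∀ (w : Vertex k) → (∀ x → x ∈ elems w → F x) → Unstable w

  one-of-pair : ∀ {w : Subset n} a b → ¬ (a ∈ w × b ∈ w) → Σ X λ c → ∀ x → x ∈ w → (x ≡ a ⊎ x ≡ b) → x ≡ c
  one-of-pair {w} a b ¬both with a ∈? w | b ∈? w
  ... | yes a∈w | yes b∈w = ⊥-elim (¬both (a∈w , b∈w))
  ... | no a∉w | _ = b , λ { x x∈w (inj₁ refl) → ⊥-elim (a∉w x∈w) ; x x∈w (inj₂ e) → e }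
  ... | yes _ | no b∉w = a , λ { x x∈w (inj₁ e) → e ; x x∈w (inj₂ refl) → ⊥-elim (b∉w x∈w) }

  -- A vertex inside {s, s+1, t} contains s and s+1 (else it would fit into a pair).
  AForm-unstable : ∀ {s t} → AllUnstable (AForm s t)
  AForm-unstable {s} {t} w w⊆ with (s ∈? elems w) ×-dec (next s ∈? elems w)
  ... | yes (s∈w , s⁺∈w) = s , s∈w , s⁺∈w
  ... | no ¬both with one-of-pair s (next s) ¬both
  ...   | c , is-c = ⊥-elim (three-not-in-pair (elems w) c t (proj₂ w) in-pair)
    where
      in-pair : ∀ x → x ∈ elems w → x ≡ c ⊎ x ≡ t
      in-pair x x∈w with w⊆ x x∈w
      ... | inj₁ e = inj₁ (is-c x x∈w (inj₁ e))
      ... | inj₂ (inj₁ e) = inj₁ (is-c x x∈w (inj₂ e))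
      ... | inj₂ (inj₂ e) = inj₂ e

  BForm-unstable : ∀ {p q} → AllUnstable (BForm p q)
  BForm-unstable {p} {q} w w⊆
    with (p ∈? elems w) ×-dec (next p ∈? elems w) | (q ∈? elems w) ×-dec (next q ∈? elems w)
  ... | yes (p∈w , p⁺∈w) | _ = p , p∈w , p⁺∈w
  ... | no _ | yes (q∈w , q⁺∈w) = q , q∈w , q⁺∈w
  ... | no ¬p-pair | no ¬q-pair with one-of-pair p (next p) ¬p-pair | one-of-pair q (next q) ¬q-pair
  ...   | c , is-c | d , is-d = ⊥-elim (three-not-in-pair (elems w) c d (proj₂ w) in-pair)
    where
      in-pair : ∀ x → x ∈ elems w → x ≡ c ⊎ x ≡ d
      in-pair x x∈w with w⊆ x x∈w
      ... | inj₁ e = inj₁ (is-c x x∈w (inj₁ e))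
      ... | inj₂ (inj₁ e) = inj₁ (is-c x x∈w (inj₂ e))
      ... | inj₂ (inj₂ (inj₁ e)) = inj₂ (is-d x x∈w (inj₁ e))
      ... | inj₂ (inj₂ (inj₂ e)) = inj₂ (is-d x x∈w (inj₂ e))

  HasUnstable : VSet k → Set
  HasUnstable σ = ∃ λ v → v ∈V σ × Unstable v

  StableInC : VSet k → Set
  StableInC σ = ∃ λ w → Stable w × (∀ x → x ∈ elems w → InC σ x)

  hasUnstable? : ∀ σ → Dec (HasUnstable σ)
  hasUnstable? σ = any-vertex? (λ v → v ∈V σ × Unstable v) (λ v → T? (σ v) ×-dec unstable? v)

  stableInC? : ∀ σ → Dec (StableInC σ)
  stableInC? σ = any-vertex? (λ w → Stable w × (∀ x → x ∈ elems w → InC σ x))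
                   (λ w → ¬? (unstable? w) ×-dec all? (λ x → (x ∈? elems w) →-dec inC? σ x))

  neighbour⊆C : ∀ {σ : VSet k} {w} → InNbr σ w → ∀ x → x ∈ elems w → InC σ x
  neighbour⊆C nbr x x∈w v v∈σ x∈v = proj₁ (nbr v v∈σ) x x∈v x∈w

  hasUnstable-mono : ∀ {τ σ} → τ ⊆V σ → HasUnstable τ → HasUnstable σ
  hasUnstable-mono τ⊆σ (v , v∈τ , v-unst) = v , τ⊆σ v v∈τ , v-unst

  stableInC-antitone : ∀ {τ σ} → τ ⊆V σ → StableInC σ → StableInC τ
  stableInC-antitone τ⊆σ (w , w-stable , w⊆C) = w , w-stable , λ x x∈w v v∈τ → w⊆C x x∈w v (τ⊆σ v v∈τ)

  SG⇒stableInC : ∀ {σ} → InNSG σ → StableInC σ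
  SG⇒stableInC (_ , _ , w , w-stable , disj) = w , w-stable , λ x x∈w v v∈σ x∈v → disj v v∈σ x x∈v x∈w

  -- An edge of S_{3,k} at an unstable vertex ends in a stable one, inside C_σ.
  Ck⇒stableInC : ∀ {σ} → InCk σ → StableInC σ
  Ck⇒stableInC {σ} ((_ , w , nbr) , v , v∈σ , v-unst) with proj₂ (nbr v v∈σ)
  ... | inj₁ v-stable = ⊥-elim (v-stable v-unst)
  ... | inj₂ w-stable = w , w-stable , neighbour⊆C {σ} {w} nbr

  form⇒¬stableInC : ∀ {σ F} → AllUnstable F → (∀ x → InC σ x → F x) → ¬ StableInC σ
  form⇒¬stableInC all-unst C⊆F (w , w-stable , w⊆C) = w-stable (all-unst w (λ x x∈w → C⊆F x (w⊆C x x∈w)))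

  A⇒¬stableInC : ∀ {s t σ} → InA s t σ → ¬ StableInC σ
  A⇒¬stableInC (_ , C⇔) = form⇒¬stableInC AForm-unstable (λ x → Equivalence.to (C⇔ x))

  B⇒¬stableInC : ∀ {s u σ} → InB s u σ → ¬ StableInC σ
  B⇒¬stableInC (_ , C⇔) = form⇒¬stableInC BForm-unstable (λ x → Equivalence.to (C⇔ x))

  -- Three pairwise apart points of C_σ would form a stable vertex inside C_σ.
  ¬stableInC⇒no-apart-triple : ∀ {σ} → ¬ StableInC σ → NoApartTriple (InC σ)
  ¬stableInC⇒no-apart-triple {σ} ¬st x y z cx cy cz x∥y y∥z x∥z with stable-vertex x y z x∥y y∥z x∥z
  ... | w , w-stable , w⊆xyz = ¬st (w , w-stable , w⊆C)
    where
      w⊆C : ∀ u → u ∈ elems w → InC σ u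
      w⊆C u u∈w with w⊆xyz u u∈w
      ... | inj₁ refl = cx
      ... | inj₂ (inj₁ refl) = cy
      ... | inj₂ (inj₂ refl) = cz

  -- (i) every edge of S_{3,k} has a stable endpoint, which must be on σ's side when the
  -- common neighbour is unstable.
  stable-side : (σ : VSet k) → InNS σ → (∃ λ w → InNbr σ w × Unstable w) →
                (v : Vertex k) → v ∈V σ → Stable v
  stable-side σ _ (w , nbr , w-unst) v v∈σ with proj₂ (nbr v v∈σ)
  ... | inj₁ v-stable = v-stable
  ... | inj₂ w-stable = ⊥-elim (w-stable w-unst)

  -- Without a stable vertex in C_σ, the common neighbour w of σ is unstable, so C_σ
  -- contains a consecutive pair t, t+1 of w and the third point of w: classify C_σ.
  shape-of-C : (σ : VSet k) → InNS σ → ¬ StableInC σ → Shape (InC σ)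
  shape-of-C σ (_ , w , nbr) ¬st = from-neighbour (unstable? w)
    where
      w⊆C : ∀ x → x ∈ elems w → InC σ x
      w⊆C = neighbour⊆C {σ} {w} nbr
      from-neighbour : Dec (Unstable w) → Shape (InC σ)
      from-neighbour (no w-stable) = ⊥-elim (¬st (w , w-stable , w⊆C))
      from-neighbour (yes (t , t∈w , t⁺∈w)) =
        let (b , b∈w , b≢t , b≢t⁺) = third-point w t in
        Classification.classify (InC σ) (inC? σ) (¬stableInC⇒no-apart-triple ¬st) t
          (w⊆C t t∈w) (w⊆C (next t) t⁺∈w) (w⊆C b b∈w , b≢t , b≢t⁺)

  shape⇒piece : (σ : VSet k) → InNS σ → Shape (InC σ) → ∃ λ p → Valid p × InPiece σ p
  shape⇒piece σ ns (a-shape s t I C⇔) = pA s t , I , ns , C⇔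
  shape⇒piece σ ns (b-shape p q I C⇔) with orient I
  ... | inj₁ pq = pB p q , pq , ns , C⇔
  ... | inj₂ qp = pB q p , qp , ns , λ x → mk⇔ (BForm-swap ∘′ Equivalence.to (C⇔ x))
                                               (Equivalence.from (C⇔ x) ∘′ BForm-swap)

  -- (ii) covering: C_k if σ has an unstable vertex, 𝒩(SG) if C_σ has a stable one,
  -- and otherwise the shape of C_σ.  (The searches are passed to helpers as arguments:
  -- abstracting them with 'with' would make the type checker evaluate them.)
  cover : (σ : VSet k) → InNS σ → ∃ λ p → Valid p × InPiece σ p
  cover σ ns = by-vertices (hasUnstable? σ)
    where
      by-C : ¬ HasUnstable σ → Dec (StableInC σ) → ∃ λ p → Valid p × InPiece σ p
      by-C ¬hu (yes (w , w-stable , w⊆C)) =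
        pSG , tt , proj₁ ns , (λ v v∈σ v-unst → ¬hu (v , v∈σ , v-unst)) ,
        w , w-stable , (λ v v∈σ x x∈v x∈w → w⊆C x x∈w v v∈σ x∈v)
      by-C _ (no ¬st) = shape⇒piece σ ns (shape-of-C σ ns ¬st)
      by-vertices : Dec (HasUnstable σ) → ∃ λ p → Valid p × InPiece σ p
      by-vertices (yes hu) = pC , tt , ns , hu
      by-vertices (no ¬hu) = by-C ¬hu (stableInC? σ)

  -- (ii) every piece lies in 𝒩(S_{3,k}): a stable common neighbour in SG is one in S.
  piece⊆NS : (σ : VSet k) (p : Piece k) → Valid p → InPiece σ p → InNS σ
  piece⊆NS σ pSG _ (ne , _ , w , w-stable , disj) = ne , w , λ v v∈σ → disj v v∈σ , inj₂ w-stable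
  piece⊆NS σ (pA _ _) _ (ns , _) = ns
  piece⊆NS σ (pB _ _) _ (ns , _) = ns
  piece⊆NS σ pC _ (ns , _) = ns

  -- An unstable vertex of τ is one of σ, so
  -- τ ∈ C_k excludes σ ∈ 𝒩(SG); a stable vertex in C_σ lies in C_τ, so τ in an A- or
  -- B-piece excludes σ ∈ C_k and σ ∈ 𝒩(SG); and τ ∈ A, σ ∈ B would put the B-form C_σ
  -- inside the A-form C_τ.
  monotone : (τ σ : VSet k) (p q : Piece k) → InNS τ → InNS σ → τ ⊆V σ →
             Valid p → Valid q → InPiece τ p → InPiece σ q → φval p ≤ φval q
  monotone τ σ pSG pSG _ _ _ _ _ _ _ = ℕ.≤-refl
  monotone τ σ pSG (pA _ _) _ _ _ _ _ _ _ = s≤s z≤n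
  monotone τ σ pSG (pB _ _) _ _ _ _ _ _ _ = s≤s z≤n
  monotone τ σ pSG pC _ _ _ _ _ _ _ = s≤s z≤n
  monotone τ σ pC pSG _ _ τ⊆σ _ _ (_ , hu) (_ , all-stable , _) =
    ⊥-elim (let (v , v∈σ , v-unst) = hasUnstable-mono τ⊆σ hu in all-stable v v∈σ v-unst)
  monotone τ σ pC (pA _ _) _ _ _ _ _ _ _ = s≤s (s≤s z≤n)
  monotone τ σ pC (pB _ _) _ _ _ _ _ _ _ = s≤s (s≤s z≤n)
  monotone τ σ pC pC _ _ _ _ _ _ _ = ℕ.≤-refl
  monotone τ σ (pB _ _) pSG _ _ τ⊆σ _ _ ip iq = ⊥-elim (B⇒¬stableInC ip (stableInC-antitone τ⊆σ (SG⇒stableInC iq)))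
  monotone τ σ (pB _ _) pC _ _ τ⊆σ _ _ ip iq = ⊥-elim (B⇒¬stableInC ip (stableInC-antitone τ⊆σ (Ck⇒stableInC iq)))
  monotone τ σ (pB _ _) (pA _ _) _ _ _ _ _ _ _ = s≤s (s≤s (s≤s z≤n))
  monotone τ σ (pB _ _) (pB _ _) _ _ _ _ _ _ _ = ℕ.≤-refl
  monotone τ σ (pA _ _) pSG _ _ τ⊆σ _ _ ip iq = ⊥-elim (A⇒¬stableInC ip (stableInC-antitone τ⊆σ (SG⇒stableInC iq)))
  monotone τ σ (pA _ _) pC _ _ τ⊆σ _ _ ip iq = ⊥-elim (A⇒¬stableInC ip (stableInC-antitone τ⊆σ (Ck⇒stableInC iq)))
  monotone τ σ (pA _ _) (pB _ _) _ _ τ⊆σ _ vq (_ , Cτ⇔) (_ , Cσ⇔) =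
    ⊥-elim (b-not-in-a (ordered⇒InI vq)
      (λ x x∈B → Equivalence.to (Cτ⇔ x) (λ v v∈τ → Equivalence.from (Cσ⇔ x) x∈B v (τ⊆σ v v∈τ))))
  monotone τ σ (pA _ _) (pA _ _) _ _ _ _ _ _ _ = ℕ.≤-refl

  same-value⇒same-piece : (σ : VSet k) (p q : Piece k) → Valid p → Valid q →
                          InPiece σ p → InPiece σ q → φval p ≡ φval q → p ≡ q
  same-value⇒same-piece σ pSG pSG _ _ _ _ _ = refl
  same-value⇒same-piece σ pC pC _ _ _ _ _ = refl
  same-value⇒same-piece σ (pA s t) (pA s' t') I I' (_ , C⇔) (_ , C⇔') _
    with a-rigid I I' (λ x → Equivalence.to (C⇔ x) ∘′ Equivalence.from (C⇔' x))
                      (λ x → Equivalence.to (C⇔' x) ∘′ Equivalence.from (C⇔ x))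
  ... | s'≡s , t'≡t = cong₂ pA (sym s'≡s) (sym t'≡t)
  same-value⇒same-piece σ (pB s u) (pB s' u') su su' (_ , C⇔) (_ , C⇔') _
    with b-rigid (ordered⇒InI su) (ordered⇒InI su') (λ x → Equivalence.to (C⇔ x) ∘′ Equivalence.from (C⇔' x))
  ... | inj₁ (s'≡s , u'≡u) = cong₂ pB (sym s'≡s) (sym u'≡u)
  ... | inj₂ (s'≡u , u'≡s) = ⊥-elim (ordered-asym su (subst₂ Ordered s'≡u u'≡s su'))
  same-value⇒same-piece σ pSG (pA _ _) _ _ _ _ ()
  same-value⇒same-piece σ pSG (pB _ _) _ _ _ _ ()
  same-value⇒same-piece σ pSG pC _ _ _ _ ()
  same-value⇒same-piece σ (pA _ _) pSG _ _ _ _ ()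
  same-value⇒same-piece σ (pA _ _) (pB _ _) _ _ _ _ ()
  same-value⇒same-piece σ (pA _ _) pC _ _ _ _ ()
  same-value⇒same-piece σ (pB _ _) pSG _ _ _ _ ()
  same-value⇒same-piece σ (pB _ _) (pA _ _) _ _ _ _ ()
  same-value⇒same-piece σ (pB _ _) pC _ _ _ _ ()
  same-value⇒same-piece σ pC pSG _ _ _ _ ()
  same-value⇒same-piece σ pC (pA _ _) _ _ _ _ ()
  same-value⇒same-piece σ pC (pB _ _) _ _ _ _ ()

  -- (ii) disjointness: applying (iii) to σ ⊆ σ in both directions equates the values of φ_k.
  unique : (σ : VSet k) (p q : Piece k) → Valid p → Valid q → InPiece σ p → InPiece σ q → p ≡ q
  unique σ p q vp vq ip iq = same-value⇒same-piece σ p q vp vq ip iq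
    (ℕ.≤-antisym (monotone σ σ p q ns ns ⊆-refl vp vq ip iq) (monotone σ σ q p ns ns ⊆-refl vq vp iq ip))
    where
      ns : InNS σ
      ns = piece⊆NS σ p vp ip
      ⊆-refl : σ ⊆V σ
      ⊆-refl _ v∈σ = v∈σ

proposition3p2 : (k : ℕ) →
    ((σ : VSet k) → InNS σ → (∃ λ (w : Vertex k) → InNbr σ w × Unstable w) →
       (v : Vertex k) → v ∈V σ → Stable v)
    × ((σ : VSet k) → InNS σ → ∃ λ (p : Piece k) → Valid p × InPiece σ p)
    × ((σ : VSet k) (p : Piece k) → Valid p → InPiece σ p → InNS σ)
    × ((σ : VSet k) (p q : Piece k) → Valid p → Valid q →
         InPiece σ p → InPiece σ q → p ≡ q)
    × ((τ σ : VSet k) (p q : Piece k) → InNS τ → InNS σ → τ ⊆V σ →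
         Valid p → Valid q → InPiece τ p → InPiece σ q → φval p ≤ φval q)
proposition3p2 k = stable-side , cover , piece⊆NS , unique , monotone
  where open Neighbourhood k
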